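{- Let $k\ge 2$ be an integer and $G$ a graph. If $G$ is $\{1*(k-2),2\}$-partitionable, then $G$ is not strictly $k$-colorable.
   Context: Graphs are finite and simple. An integer partition $\lambda$ of a positive integer $k$ is a multiset of positive integers summing to $k$; $a*b$ denotes $b$ copies of $a$, so $\{1*(k-2),2\}$ consists of $k-2$ ones and one $2$. A $k$-assignment $L$ of $G$ assigns to each vertex $v$ a set $L(v)$ of $k$ colors; $G$ is $L$-colorable if there is a proper coloring with each vertex $v$ receiving a color from $L(v)$; $G$ is $k$-choosable if it is $L$-colorable for every $k$-assignment. For $\lambda=\{k_1,\dots,k_t\}$, a $\lambda$-assignment of $G$ is a $k$-assignment $L$ such that $\bigcup_{v}L(v)$ can be partitioned into sets $C_1,\dots,C_t$ with $|L(v)\cap C_i|=k_i$ for every vertex $v$ and every $i$; $G$ is $\lambda$-choosable if $G$ is $L$-colorable for every $\lambda$-assignment $L$. $G$ is $\lambda$-partitionable if there is a partition $V_1,\dots,V_t$ of $V(G)$ such that $G[V_i]$ is $k_i$-choosable for each $i$. (It is known that $G$ is $\{1*k\}$-choosable iff $G$ is $k$-colorable.) A graph $G$ is strictly $k$-colorable if $\{1*k\}$ is the only integer partition $\lambda$ of $k$ for which $G$ is $\lambda$-choosable, i.e. $G$ is $\{1*k\}$-choosable and not $\lambda$-choosable for any other partition $\lambda$ of $k$. -}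

module Defs where

open import Data.Nat using (ℕ; _≤_; _∸_)
open import Data.Bool using (Bool; true; false)
open import Data.Fin using (Fin)
import Data.Fin as Fin
open import Data.List using (List; []; _∷_; length; replicate; filter; lookup; _++_)
open import Data.Nat.ListAction using (sum)
open import Data.List.Membership.Propositional using (_∈_)
open import Data.List.Relation.Unary.All using (All)
open import Data.List.Relation.Unary.Unique.Propositional using (Unique)
open import Data.List.Relation.Binary.Permutation.Propositional using (_↭_)
open import Data.Product using (Σ; _×_; ∃)
open import Relation.Binary.PropositionalEquality using (_≡_; _≢_)
open import Relation.Nullary using (¬_)
open import Data.Unit using (⊤)

record Graph : Set where
  field
    n      : ℕ
    adj    : Fin n → Fin n → Bool
    sym    : ∀ u v → adj u v ≡ adj v u
    irrefl : ∀ v → adj v v ≡ false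

open Graph public

Vertex : Graph → Set
Vertex G = Fin (n G)

Adjacent : (G : Graph) → Vertex G → Vertex G → Set
Adjacent G u v = adj G u v ≡ true

ListAssignment : Graph → Set
ListAssignment G = Vertex G → List ℕ

-- Vertex subsets (used for induced subgraphs G[S]).
VSet : Graph → Set₁
VSet G = Vertex G → Set

IsKAssignmentOn : (G : Graph) → VSet G → ℕ → ListAssignment G → Set
IsKAssignmentOn G S k L = ∀ v → S v → Unique (L v) × length (L v) ≡ k

IsLColorableOn : (G : Graph) → VSet G → ListAssignment G → Set
IsLColorableOn G S L =
  Σ (Vertex G → ℕ) λ c →
    (∀ v → S v → c v ∈ L v) ×
    (∀ u v → S u → S v → Adjacent G u v → c u ≢ c v)

ChoosableOn : (G : Graph) → VSet G → ℕ → Set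
ChoosableOn G S k = ∀ (L : ListAssignment G) → IsKAssignmentOn G S k L → IsLColorableOn G S L

AllV : (G : Graph) → VSet G
AllV G v = ⊤

-- An integer partition of k, represented as a list (a multiset up to permutation _↭_).
IsPartition : ℕ → List ℕ → Set
IsPartition k λs = All (1 ≤_) λs × sum λs ≡ k

-- L is a λ-assignment: a (sum λ)-assignment of G together with a partition of the colours
-- into classes C_1..C_t (colour c lies in class part c) with |L(v) ∩ C_i| = k_i.
IsPartAssignment : (G : Graph) → List ℕ → ListAssignment G → Set
IsPartAssignment G λs L =
  IsKAssignmentOn G (AllV G) (sum λs) L ×
  Σ (ℕ → Fin (length λs)) λ part →
    ∀ (v : Vertex G) (i : Fin (length λs)) →
      length (filter (λ c → part c Fin.≟ i) (L v)) ≡ lookup λs i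

PartChoosable : Graph → List ℕ → Set
PartChoosable G λs = ∀ (L : ListAssignment G) → IsPartAssignment G λs L → IsLColorableOn G (AllV G) L

-- λ-partitionable: V(G) = V_1 ∪ ... ∪ V_t (vertex v in V_{p v}) with G[V_i] k_i-choosable.
Partitionable : Graph → List ℕ → Set
Partitionable G λs =
  Σ (Vertex G → Fin (length λs)) λ p →
    ∀ (i : Fin (length λs)) → ChoosableOn G (λ v → p v ≡ i) (lookup λs i)

StrictlyColorable : Graph → ℕ → Set
StrictlyColorable G k =
  PartChoosable G (replicate k 1) ×
  (∀ (λs : List ℕ) → IsPartition k λs → ¬ (λs ↭ replicate k 1) → ¬ PartChoosable G λs)

-- A λ-partition V₁, …, V_t with G[Vᵢ] kᵢ-choosable makes G λ-choosable: given a
-- λ-assignment with colour classes C₁, …, C_t, colour G[Vᵢ] from the lists L(v) ∩ Cᵢ,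
-- which have exactly kᵢ colours. Adjacent vertices in the same part are coloured
-- properly by construction, and those in different parts receive colours from disjoint
-- classes. As {1*(k-2), 2} is a partition of k different from {1*k}, G is then
-- λ-choosable for a partition other than {1*k}.
module Submission where

open import Defs
open import Data.Nat using (ℕ; _≤_; _∸_; suc; zero; s≤s; z≤n)
open import Data.Nat.ListAction using (sum)
open import Data.List using (List; []; _∷_; replicate; _++_; filter; length; lookup)
open import Data.List.Membership.Propositional using (_∈_)
open import Data.List.Membership.Propositional.Properties using (∈-filter⁻)
open import Data.List.Relation.Unary.All using (All; []; _∷_)
open import Data.List.Relation.Unary.All.Properties using (replicate⁺; ++⁻ʳ)
import Data.List.Relation.Unary.Unique.Propositional.Properties as Unique
open import Data.List.Relation.Binary.Permutation.Propositional using (_↭_; ↭-sym)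
open import Data.List.Relation.Binary.Permutation.Propositional.Properties using (All-resp-↭)
open import Data.Fin using (Fin)
import Data.Fin as Fin
open import Data.Product using (_,_; proj₁; proj₂)
open import Data.Unit using (tt)
open import Relation.Binary.PropositionalEquality using (_≡_; _≢_; refl; trans; cong)
import Relation.Binary.PropositionalEquality as ≡
open import Relation.Nullary using (¬_; yes; no)

Partitionable⇒PartChoosable : ∀ {G λs} → Partitionable G λs → PartChoosable G λs
Partitionable⇒PartChoosable {G} {λs} (p , choosable) L (isAssignment , part , classSize) =
  colour , (λ v _ → colour∈L v) , (λ u v _ _ → proper u v)
  where
  L[_] : Fin (length λs) → ListAssignment G
  L[ i ] v = filter (λ c → part c Fin.≟ i) (L v)

  L[i]-isAssignment : ∀ i → IsKAssignmentOn G (λ v → p v ≡ i) (lookup λs i) L[ i ]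
  L[i]-isAssignment i v _ =
    Unique.filter⁺ (λ c → part c Fin.≟ i) (proj₁ (isAssignment v tt)) , classSize v i

  colouring : ∀ i → IsLColorableOn G (λ v → p v ≡ i) L[ i ]
  colouring i = choosable i L[ i ] (L[i]-isAssignment i)

  colour : Vertex G → ℕ
  colour v = proj₁ (colouring (p v)) v

  colour∈L[p] : ∀ v → colour v ∈ L[ p v ] v
  colour∈L[p] v = proj₁ (proj₂ (colouring (p v))) v refl

  colour∈L : ∀ v → colour v ∈ L v
  colour∈L v = proj₁ (∈-filter⁻ (λ c → part c Fin.≟ p v) {xs = L v} (colour∈L[p] v))

  class-colour : ∀ v → part (colour v) ≡ p v
  class-colour v = proj₂ (∈-filter⁻ (λ c → part c Fin.≟ p v) {xs = L v} (colour∈L[p] v))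

  properWithinPart : ∀ {u v} → p u ≡ p v → Adjacent G u v → colour u ≢ colour v
  properWithinPart {u} {v} same rewrite same = proj₂ (proj₂ (colouring (p v))) u v same refl

  proper : ∀ u v → Adjacent G u v → colour u ≢ colour v
  proper u v uv with p u Fin.≟ p v
  ... | yes same = properWithinPart same uv
  ... | no different = λ equal →
    different (trans (≡.sym (class-colour u)) (trans (cong part equal) (class-colour v)))

onesAndTwo : ℕ → List ℕ
onesAndTwo m = replicate m 1 ++ 2 ∷ []

onesAndTwo-isPartition : ∀ m → IsPartition (suc (suc m)) (onesAndTwo m)
onesAndTwo-isPartition m = positive m , sum-onesAndTwo m
  where
  positive : ∀ n → All (1 ≤_) (onesAndTwo n)
  positive zero    = s≤s z≤n ∷ []
  positive (suc n) = s≤s z≤n ∷ positive n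

  sum-onesAndTwo : ∀ n → sum (onesAndTwo n) ≡ suc (suc n)
  sum-onesAndTwo zero    = refl
  sum-onesAndTwo (suc n) = cong suc (sum-onesAndTwo n)

onesAndTwo-≁-ones : ∀ m → ¬ (onesAndTwo m ↭ replicate (suc (suc m)) 1)
onesAndTwo-≁-ones m perm = two≢one (++⁻ʳ (replicate m 1) onesAndTwo-allOne)
  where
  onesAndTwo-allOne : All (_≡ 1) (onesAndTwo m)
  onesAndTwo-allOne = All-resp-↭ (↭-sym perm) (replicate⁺ (suc (suc m)) refl)

  two≢one : ¬ All (_≡ 1) (2 ∷ [])
  two≢one (() ∷ [])

mainTheorem9 : (k : ℕ) → 2 ≤ k → (G : Graph) →
    Partitionable G (replicate (k ∸ 2) 1 ++ (2 ∷ [])) → ¬ StrictlyColorable G k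
mainTheorem9 (suc (suc m)) (s≤s (s≤s z≤n)) G partitionable (_ , onlyOnesChoosable) =
  onlyOnesChoosable (onesAndTwo m) (onesAndTwo-isPartition m) (onesAndTwo-≁-ones m)
    (Partitionable⇒PartChoosable {G} {onesAndTwo m} partitionable)
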